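{- Let $1<c_2<c_3<c_4<c_5$ be natural numbers. The coin system $\$_1=\langle 1,c_2,c_3,c_4\rangle$ is non-canonical and the coin system $\$_2=\langle 1,c_2,c_3,c_4,c_5\rangle$ is canonical if and only if $c_3>3$ and $\$_2=\langle 1,2,c_3,c_3+1,2c_3\rangle$ (i.e. $c_2=2$, $c_4=c_3+1$, $c_5=2c_3$).
   Context: A coin system is a tuple $\langle c_1,\dots,c_m\rangle$ of natural numbers with $1=c_1<c_2<\cdots<c_m$. A representation of $x$ is a tuple $(\alpha_1,\dots,\alpha_m)$ of natural numbers with $\sum_i\alpha_ic_i=x$, of size $\sum_i\alpha_i$. The greedy representation $\mathrm{GRD}(x)$ is the representation with $\sum_{j<i}\alpha_jc_j<c_i$ for all $2\le i\le m$; $\mathrm{OPT}(x)$ is a representation of minimum size. The system is canonical if $|\mathrm{GRD}(x)|=|\mathrm{OPT}(x)|$ for all $x$, and non-canonical otherwise. -}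

module Defs where

open import Data.Nat using (ℕ; zero; suc; _+_; _*_; _≤_; _<_)
open import Data.Vec using (Vec; []; _∷_; lookup; zipWith)
open import Data.Vec using () renaming (sum to vsum)
open import Data.Fin using (Fin; toℕ)
open import Relation.Binary.PropositionalEquality using (_≡_)
open import Relation.Nullary using (¬_)

-- A coin system with m coins is a vector c = ⟨c_1,…,c_m⟩ (c_1 = 1, strictly increasing;
-- in the theorem these conditions are hypotheses on explicit coins).

value : ∀ {m} → Vec ℕ m → Vec ℕ m → ℕ
value c α = vsum (zipWith _*_ α c)

size : ∀ {m} → Vec ℕ m → ℕ
size α = vsum α

-- partial value Σ_{j<k} α_j c_j (indices 0-based, first k coins)
prefixValue : ∀ {m} → ℕ → Vec ℕ m → Vec ℕ m → ℕ
prefixValue zero    _        _        = 0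
prefixValue (suc k) []       []       = 0
prefixValue (suc k) (c ∷ cs) (a ∷ as) = a * c + prefixValue k cs as

IsRep : ∀ {m} → Vec ℕ m → ℕ → Vec ℕ m → Set
IsRep c x α = value c α ≡ x

-- α is the greedy representation of x:  Σ_{j<i} α_j c_j < c_i  for all 2 ≤ i ≤ m
-- (1-based i; here the 0-based index i has toℕ i ≥ 1)
IsGreedy : ∀ {m} → Vec ℕ m → ℕ → Vec ℕ m → Set
IsGreedy {m} c x α =
  IsRep c x α × ((i : Fin m) → 1 ≤ toℕ i → prefixValue (toℕ i) c α < lookup c i)
  where open import Data.Product using (_×_)

IsOpt : ∀ {m} → Vec ℕ m → ℕ → Vec ℕ m → Set
IsOpt {m} c x α = IsRep c x α × ((β : Vec ℕ m) → IsRep c x β → size α ≤ size β)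
  where open import Data.Product using (_×_)

Canonical : ∀ {m} → Vec ℕ m → Set
Canonical {m} c = (x : ℕ) (g o : Vec ℕ m) → IsGreedy c x g → IsOpt c x o → size g ≡ size o

NonCanonical : ∀ {m} → Vec ℕ m → Set
NonCanonical c = ¬ Canonical c

-- For a coin system whose greedy size function is G, canonicity is equivalent to the bound
-- G (c + y) ≤ G y + 1 for every coin c and every y: summed along an optimal representation it
-- bounds G by the optimum, and conversely one more coin c on the greedy representation of y
-- represents c + y.  The greedy sizes G₄ of $₁ and G₅ of $₂ agree below e = c₅, so when $₂ is
-- canonical G₄ can only violate the bound at k + y with e ≤ k + y < b + d and y < d.  Canonicity
-- of $₂ gives G₅ ≤ 2 at 2b, b + d and 2d, which forces d to be a + b - 1, 2b - 1 or 2b - a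
-- (with e = b + d - 1, b + d - 1, b + d - a), and in each case the bound for G₄ holds in that
-- window unless a = 2, d = b + 1, e = 2b and b > 3.  For this last system the greedy
-- representation d + (b - 1) of 2b has at least three coins, and the bound for G₅ is checked
-- coin by coin.

module Submission where

open import Defs
open import Data.Empty using (⊥-elim)
open import Data.Fin using (Fin; toℕ; fromℕ; inject₁) renaming (zero to fzero; suc to fsuc)
open import Data.Fin.Properties using (toℕ-inject₁)
open import Data.Nat
open import Data.Nat.DivMod
open import Data.Nat.Properties
open import Algebra.Properties.CommutativeSemigroup +-commutativeSemigroup
  using (x∙yz≈y∙xz; x∙yz≈xz∙y; xy∙z≈xz∙y; xy∙z≈yz∙x)
open import Data.Product
open import Data.Sum using (_⊎_; inj₁; inj₂)
open import Data.Vec using (Vec; []; _∷_; _∷ʳ_; lookup; updateAt; initLast)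
open import Function using (id; _∘_)
open import Function.Bundles using (_⇔_; mk⇔)
open import Relation.Nullary using (¬_; yes; no; Dec)
open import Relation.Nullary.Decidable using (map′; _×-dec_)
open import Relation.Binary.PropositionalEquality
open import Data.Nat.Tactic.RingSolver using (solve-∀)

-- Greedy size functions

IsGreedySize : ∀ {m} → Vec ℕ m → (ℕ → ℕ) → Set
IsGreedySize c G = (∀ x → ∃ (IsGreedy c x)) × (∀ {x g} → IsGreedy c x g → size g ≡ G x)

CoinLipschitz : (ℕ → ℕ) → ℕ → Set
CoinLipschitz G k = ∀ y → G (k + y) ≤ suc (G y)

Lipschitz : ∀ {m} → Vec ℕ m → (ℕ → ℕ) → Set
Lipschitz {m} c G = (i : Fin m) → CoinLipschitz G (lookup c i)

-- The greedy size of a system extended by a top coin k, given the greedy size F of the system.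
addCoin : (k : ℕ) .{{_ : NonZero k}} → (ℕ → ℕ) → ℕ → ℕ
addCoin k F x = x / k + F (x % k)

module _ (k : ℕ) .{{_ : NonZero k}} (F : ℕ → ℕ) where

  addCoin-< : ∀ {x} → x < k → addCoin k F x ≡ F x
  addCoin-< x<k = cong₂ _+_ (m<n⇒m/n≡0 x<k) (cong F (m<n⇒m%n≡m x<k))

  addCoin-+ : ∀ x → addCoin k F (k + x) ≡ suc (addCoin k F x)
  addCoin-+ x = cong₂ _+_ quotient (cong F remainder)
    where
    quotient : (k + x) / k ≡ suc (x / k)
    quotient = trans (m/n≡1+[m∸n]/n (m≤m+n k x)) (cong (λ z → suc (z / k)) (m+n∸m≡n k x))
    remainder : (k + x) % k ≡ x % k
    remainder = trans (cong (_% k) (+-comm k x)) ([m+n]%n≡m%n x k)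

  addCoin-*+ : ∀ q x → addCoin k F (q * k + x) ≡ q + addCoin k F x
  addCoin-*+ zero    x = refl
  addCoin-*+ (suc q) x = begin
    addCoin k F (k + q * k + x)   ≡⟨ cong (addCoin k F) (+-assoc k (q * k) x) ⟩
    addCoin k F (k + (q * k + x)) ≡⟨ addCoin-+ (q * k + x) ⟩
    suc (addCoin k F (q * k + x)) ≡⟨ cong suc (addCoin-*+ q x) ⟩
    suc (q + addCoin k F x)       ∎
    where open ≡-Reasoning

  addCoin-pos : (∀ {x} → 0 < x → 0 < F x) → ∀ {x} → 0 < x → 0 < addCoin k F x
  addCoin-pos F-pos {x} 0<x with x <? k
  ... | yes x<k = subst (0 <_) (sym (addCoin-< x<k)) (F-pos 0<x)
  ... | no x≮k with m≤n⇒∃[o]m+o≡n (≮⇒≥ x≮k)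
  ...   | w , refl = subst (0 <_) (sym (addCoin-+ w)) z<s

  addCoin-≤1 : (∀ {x} → 0 < x → 0 < F x) → ∀ {x} → addCoin k F x ≤ 1 → F x ≤ 1 ⊎ x ≡ k
  addCoin-≤1 F-pos {x} ≤1 with x <? k
  ... | yes x<k = inj₁ (subst (_≤ 1) (addCoin-< x<k) ≤1)
  ... | no x≮k with m≤n⇒∃[o]m+o≡n (≮⇒≥ x≮k)
  ...   | zero  , refl = inj₂ (+-identityʳ k)
  ...   | suc w , refl =
    ⊥-elim (<⇒≱ (addCoin-pos F-pos z<s) (≤-pred (subst (_≤ 1) (addCoin-+ (suc w)) ≤1)))

  -- addCoin k F counts multiples of k exactly, so the bound needs checking only for y < k.
  addCoin-lipschitz-below : ∀ l n →
    (∀ y → y < k → l + y < n → addCoin k F (l + y) ≤ suc (addCoin k F y)) →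
    ∀ y → l + y < n → addCoin k F (l + y) ≤ suc (addCoin k F y)
  addCoin-lipschitz-below l n residue y l+y<n = begin
    G (l + y)           ≡⟨ cong G l+y≡ ⟩
    G (q * k + (l + r)) ≡⟨ addCoin-*+ q (l + r) ⟩
    q + G (l + r)       ≤⟨ +-monoʳ-≤ q (residue r (m%n<n y k) l+r<n) ⟩
    q + suc (G r)       ≡⟨ +-suc q (G r) ⟩
    suc (q + G r)       ≡⟨ cong suc (sym (trans (cong G y≡) (addCoin-*+ q r))) ⟩
    suc (G y)           ∎
    where
    open ≤-Reasoning
    G : ℕ → ℕ
    G = addCoin k F
    q r : ℕ
    q = y / k
    r = y % k
    y≡ : y ≡ q * k + r
    y≡ = trans (m≡m%n+[m/n]*n y k) (+-comm r (q * k))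
    l+y≡ : l + y ≡ q * k + (l + r)
    l+y≡ = trans (cong (l +_) y≡) (x∙yz≈y∙xz l (q * k) r)
    l+r<n : l + r < n
    l+r<n = ≤-<-trans (+-monoʳ-≤ l (m%n≤m y k)) l+y<n

  addCoin-lipschitz : ∀ l → (∀ y → y < k → addCoin k F (l + y) ≤ suc (addCoin k F y)) →
    CoinLipschitz (addCoin k F) l
  addCoin-lipschitz l residue y =
    addCoin-lipschitz-below l (suc (l + y)) (λ y′ y′<k _ → residue y′ y′<k) y ≤-refl

value-∷ʳ : ∀ {m} (c α : Vec ℕ m) e n → value (c ∷ʳ e) (α ∷ʳ n) ≡ value c α + n * e
value-∷ʳ []      []      e n = +-identityʳ (n * e)
value-∷ʳ (c ∷ cs) (a ∷ α) e n =
  trans (cong (a * c +_) (value-∷ʳ cs α e n)) (sym (+-assoc (a * c) _ _))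

size-∷ʳ : ∀ {m} (α : Vec ℕ m) n → size (α ∷ʳ n) ≡ size α + n
size-∷ʳ []      n = +-identityʳ n
size-∷ʳ (a ∷ α) n = trans (cong (a +_) (size-∷ʳ α n)) (sym (+-assoc a _ n))

prefixValue-∷ʳ-inject₁ : ∀ {m} (c α : Vec ℕ m) {e n} (j : Fin m) →
  prefixValue (toℕ (inject₁ j)) (c ∷ʳ e) (α ∷ʳ n) ≡ prefixValue (toℕ j) c α
prefixValue-∷ʳ-inject₁ (c ∷ cs) (a ∷ α) fzero    = refl
prefixValue-∷ʳ-inject₁ (c ∷ cs) (a ∷ α) (fsuc j) = cong (a * c +_) (prefixValue-∷ʳ-inject₁ cs α j)

prefixValue-∷ʳ-fromℕ : ∀ {m} (c α : Vec ℕ m) {e n} →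
  prefixValue (toℕ (fromℕ m)) (c ∷ʳ e) (α ∷ʳ n) ≡ value c α
prefixValue-∷ʳ-fromℕ []       []      = refl
prefixValue-∷ʳ-fromℕ (c ∷ cs) (a ∷ α) = cong (a * c +_) (prefixValue-∷ʳ-fromℕ cs α)

lookup-∷ʳ-inject₁ : ∀ {m} (c : Vec ℕ m) {e} i → lookup (c ∷ʳ e) (inject₁ i) ≡ lookup c i
lookup-∷ʳ-inject₁ (c ∷ cs) fzero    = refl
lookup-∷ʳ-inject₁ (c ∷ cs) (fsuc i) = lookup-∷ʳ-inject₁ cs i

lookup-∷ʳ-fromℕ : ∀ {m} (c : Vec ℕ m) {e} → lookup (c ∷ʳ e) (fromℕ m) ≡ e
lookup-∷ʳ-fromℕ []       = refl
lookup-∷ʳ-fromℕ (c ∷ cs) = lookup-∷ʳ-fromℕ cs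

inject₁-or-fromℕ : ∀ {m} (i : Fin (suc m)) → (∃ λ j → inject₁ j ≡ i) ⊎ fromℕ m ≡ i
inject₁-or-fromℕ {zero}  fzero    = inj₂ refl
inject₁-or-fromℕ {suc m} fzero    = inj₁ (fzero , refl)
inject₁-or-fromℕ {suc m} (fsuc i) with inject₁-or-fromℕ i
... | inj₁ (j , refl) = inj₁ (fsuc j , refl)
... | inj₂ refl       = inj₂ refl

module _ {m} (c : Vec ℕ (suc m)) (e : ℕ) where

  isGreedy-∷ʳ : ∀ {r α} n → IsGreedy c r α → r < e → IsGreedy (c ∷ʳ e) (r + n * e) (α ∷ʳ n)
  isGreedy-∷ʳ {α = α} n (rep , below) r<e = trans (value-∷ʳ c α e n) (cong (_+ n * e) rep) , below′
    where
    below′ : ∀ i → 1 ≤ toℕ i → prefixValue (toℕ i) (c ∷ʳ e) (α ∷ʳ n) < lookup (c ∷ʳ e) i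
    below′ i 1≤i with inject₁-or-fromℕ i
    ... | inj₁ (j , refl) =
      subst₂ _<_ (sym (prefixValue-∷ʳ-inject₁ c α j)) (sym (lookup-∷ʳ-inject₁ c j))
                 (below j (subst (1 ≤_) (toℕ-inject₁ j) 1≤i))
    ... | inj₂ refl =
      subst₂ _<_ (sym (trans (prefixValue-∷ʳ-fromℕ c α) rep)) (sym (lookup-∷ʳ-fromℕ c)) r<e

  isGreedy-∷ʳ⁻ : ∀ {x α n} → IsGreedy (c ∷ʳ e) x (α ∷ʳ n) → IsGreedy c (value c α) α × value c α < e
  isGreedy-∷ʳ⁻ {α = α} (_ , below) = (refl , below′) , top
    where
    below′ : ∀ j → 1 ≤ toℕ j → prefixValue (toℕ j) c α < lookup c j
    below′ j 1≤j = subst₂ _<_ (prefixValue-∷ʳ-inject₁ c α j) (lookup-∷ʳ-inject₁ c j)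
                              (below (inject₁ j) (subst (1 ≤_) (sym (toℕ-inject₁ j)) 1≤j))
    top : value c α < e
    top = subst₂ _<_ (prefixValue-∷ʳ-fromℕ c α) (lookup-∷ʳ-fromℕ c) (below (fromℕ (suc m)) (s≤s z≤n))

  greedySize-∷ʳ : ∀ {G} .{{_ : NonZero e}} → IsGreedySize c G → IsGreedySize (c ∷ʳ e) (addCoin e G)
  greedySize-∷ʳ {G} (greedy , size≡) = greedy′ , size≡′
    where
    greedy′ : ∀ x → ∃ (IsGreedy (c ∷ʳ e) x)
    greedy′ x with greedy (x % e)
    ... | α , α-greedy = α ∷ʳ x / e ,
      subst (λ y → IsGreedy (c ∷ʳ e) y (α ∷ʳ x / e)) (sym (m≡m%n+[m/n]*n x e))
            (isGreedy-∷ʳ (x / e) α-greedy (m%n<n x e))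
    size≡′ : ∀ {x g} → IsGreedy (c ∷ʳ e) x g → size g ≡ addCoin e G x
    size≡′ {x} {g} g-greedy with initLast g
    ... | α , n , refl with isGreedy-∷ʳ⁻ g-greedy
    ...   | α-greedy , r<e = begin
      size (α ∷ʳ n)                ≡⟨ trans (size-∷ʳ α n) (+-comm (size α) n) ⟩
      n + size α                   ≡⟨ cong (n +_) (size≡ α-greedy) ⟩
      n + G r                      ≡⟨ cong (n +_) (addCoin-< e G r<e) ⟨
      n + addCoin e G r            ≡⟨ addCoin-*+ e G n r ⟨
      addCoin e G (n * e + r)      ≡⟨ cong (addCoin e G) n*e+r≡x ⟩
      addCoin e G x                ∎
      where
      open ≡-Reasoning
      r : ℕ
      r = value c α
      n*e+r≡x : n * e + r ≡ x
      n*e+r≡x = trans (+-comm (n * e) r) (trans (sym (value-∷ʳ c α e n)) (proj₁ g-greedy))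

greedySize-[1] : IsGreedySize (1 ∷ []) id
greedySize-[1] = greedy , size≡
  where
  greedy : ∀ x → ∃ (IsGreedy (1 ∷ []) x)
  greedy x = x ∷ [] , trans (+-identityʳ (x * 1)) (*-identityʳ x) , λ { fzero () }
  size≡ : ∀ {x g} → IsGreedy (1 ∷ []) x g → size g ≡ x
  size≡ {g = n ∷ []} (rep , _) = trans (cong (_+ 0) (sym (*-identityʳ n))) rep

-- Canonicity as a Lipschitz bound

lipschitz-*+ : ∀ {G k} → CoinLipschitz G k → ∀ n y → G (n * k + y) ≤ n + G y
lipschitz-*+         lip zero    y = ≤-refl
lipschitz-*+ {G} {k} lip (suc n) y = begin
  G (k + n * k + y)   ≡⟨ cong G (+-assoc k (n * k) y) ⟩
  G (k + (n * k + y)) ≤⟨ lip (n * k + y) ⟩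
  suc (G (n * k + y)) ≤⟨ s≤s (lipschitz-*+ lip n y) ⟩
  suc (n + G y)       ∎
  where open ≤-Reasoning

lipschitz-value : ∀ {m} {c : Vec ℕ m} {G} → Lipschitz c G → ∀ α y → G (value c α + y) ≤ size α + G y
lipschitz-value {c = []}         lip []      y = ≤-refl
lipschitz-value {c = k ∷ cs} {G} lip (n ∷ α) y = begin
  G (n * k + value cs α + y)   ≡⟨ cong G (+-assoc (n * k) _ y) ⟩
  G (n * k + (value cs α + y)) ≤⟨ lipschitz-*+ (lip fzero) n _ ⟩
  n + G (value cs α + y)       ≤⟨ +-monoʳ-≤ n (lipschitz-value (lip ∘ fsuc) α y) ⟩
  n + (size α + G y)           ≡⟨ +-assoc n (size α) (G y) ⟨
  n + size α + G y             ∎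
  where open ≤-Reasoning

lipschitz-bound : ∀ {m} {c : Vec ℕ m} {G x} → G 0 ≡ 0 → Lipschitz c G → ∀ α → IsRep c x α → G x ≤ size α
lipschitz-bound {c = c} {G} G0 lip α refl =
  subst₂ _≤_ (cong G (+-identityʳ (value c α))) (trans (cong (size α +_) G0) (+-identityʳ (size α)))
         (lipschitz-value lip α 0)

lipschitz-two-coins : ∀ {G k l} → G 0 ≡ 0 → CoinLipschitz G k → CoinLipschitz G l → G (k + l) ≤ 2
lipschitz-two-coins {G} {k} {l} G0 lip-k lip-l = ≤-trans (lip-k l) (s≤s G[l]≤1)
  where
  G[l]≤1 : G l ≤ 1
  G[l]≤1 = subst₂ _≤_ (cong G (+-identityʳ l)) (cong suc G0) (lip-l 0)

RepWithin : ∀ {m} → Vec ℕ m → ℕ → ℕ → Set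
RepWithin {m} c x n = Σ (Vec ℕ m) λ α → IsRep c x α × size α ≤ n

repWithin? : ∀ {m} (c : Vec ℕ m) x n → Dec (RepWithin c x n)
repWithin? []       x n = map′ (λ 0≡x → [] , 0≡x , z≤n) (λ { ([] , 0≡x , _) → 0≡x }) (0 ≟ x)
repWithin? (k ∷ cs) x n = map′ combine split (anyUpTo? first? (suc n))
  where
  First : ℕ → Set
  First a = a * k ≤ x × RepWithin cs (x ∸ a * k) (n ∸ a)
  first? : ∀ a → Dec (First a)
  first? a = (a * k ≤? x) ×-dec repWithin? cs (x ∸ a * k) (n ∸ a)
  combine : ∃ (λ a → a < suc n × First a) → RepWithin (k ∷ cs) x n
  combine (a , s≤s a≤n , ak≤x , α , rep , α≤) =
    a ∷ α , trans (cong (a * k +_) rep) (m+[n∸m]≡n ak≤x) ,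
    ≤-trans (+-monoʳ-≤ a α≤) (≤-reflexive (m+[n∸m]≡n a≤n))
  split : RepWithin (k ∷ cs) x n → ∃ (λ a → a < suc n × First a)
  split (a ∷ α , rep , α≤) =
    a , s≤s (≤-trans (m≤m+n a (size α)) α≤) , subst (a * k ≤_) rep (m≤m+n (a * k) _) ,
    α , trans (sym (m+n∸m≡n (a * k) _)) (cong (_∸ a * k) rep) ,
    ≤-trans (≤-reflexive (sym (m+n∸m≡n a (size α)))) (∸-monoˡ-≤ a α≤)

optimal-exists : ∀ {m} (c : Vec ℕ m) {x} α → IsRep c x α → ∃ (IsOpt c x)
optimal-exists c {x} α rep = descend (size α) α rep ≤-refl
  where
  descend : ∀ n α → IsRep c x α → size α ≤ n → ∃ (IsOpt c x)
  descend n α rep α≤n with size α in eq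
  ... | zero = α , rep , λ β _ → subst (_≤ size β) (sym eq) z≤n
  ... | suc s with repWithin? c x s | n | α≤n
  ...   | no ∄smaller | _ | _ =
    α , rep , λ β β-rep → subst (_≤ size β) (sym eq) (≰⇒> λ β≤s → ∄smaller (β , β-rep , β≤s))
  ...   | yes (β , β-rep , β≤s) | suc n′ | s≤s s≤n′ = descend n′ β β-rep (≤-trans β≤s s≤n′)

value-updateAt-suc : ∀ {m} (c α : Vec ℕ m) i → value c (updateAt α i suc) ≡ lookup c i + value c α
value-updateAt-suc (k ∷ cs) (n ∷ α) fzero    = +-assoc k (n * k) _
value-updateAt-suc (k ∷ cs) (n ∷ α) (fsuc i) = begin
  n * k + value cs (updateAt α i suc)   ≡⟨ cong (n * k +_) (value-updateAt-suc cs α i) ⟩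
  n * k + (lookup cs i + value cs α)    ≡⟨ x∙yz≈y∙xz (n * k) (lookup cs i) _ ⟩
  lookup cs i + (n * k + value cs α)    ∎
  where open ≡-Reasoning

size-updateAt-suc : ∀ {m} (α : Vec ℕ m) i → size (updateAt α i suc) ≡ suc (size α)
size-updateAt-suc (n ∷ α) fzero    = refl
size-updateAt-suc (n ∷ α) (fsuc i) = trans (cong (n +_) (size-updateAt-suc α i)) (+-suc n (size α))

lipschitz⇒canonical : ∀ {m} {c : Vec ℕ m} {G} → IsGreedySize c G → G 0 ≡ 0 → Lipschitz c G → Canonical c
lipschitz⇒canonical (_ , size≡) G0 lip x g o g-greedy (o-rep , o-min) =
  ≤-antisym (≤-trans (≤-reflexive (size≡ g-greedy)) (lipschitz-bound G0 lip o o-rep))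
            (o-min g (proj₁ g-greedy))

canonical⇒lipschitz : ∀ {m} {c : Vec ℕ m} {G} → IsGreedySize c G → Canonical c → Lipschitz c G
canonical⇒lipschitz {c = c} {G} (greedy , size≡) canonical i y =
  let g , g-greedy = greedy y
      h , h-greedy = greedy (lookup c i + y)
      g′ = updateAt g i suc
      g′-rep = trans (value-updateAt-suc c g i) (cong (lookup c i +_) (proj₁ g-greedy))
      o , o-opt = optimal-exists c g′ g′-rep
  in begin
    G (lookup c i + y) ≡⟨ size≡ h-greedy ⟨
    size h             ≡⟨ canonical _ h o h-greedy o-opt ⟩
    size o             ≤⟨ proj₂ o-opt g′ g′-rep ⟩
    size g′            ≡⟨ size-updateAt-suc g i ⟩
    suc (size g)       ≡⟨ cong suc (size≡ g-greedy) ⟩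
    suc (G y)          ∎
  where open ≤-Reasoning

-- Systems of four and five coins

x+2≡m+[2+k]⇒x≡m+k : ∀ {x} m k → x + 2 ≡ m + (2 + k) → x ≡ m + k
x+2≡m+[2+k]⇒x≡m+k {x} m k eq =
  +-cancelʳ-≡ 2 x (m + k) (trans eq (trans (cong (m +_) (+-comm 2 k)) (sym (+-assoc m k 2))))

module FiveCoins (a b d e : ℕ) .{{_ : NonZero a}} .{{_ : NonZero b}} .{{_ : NonZero d}} .{{_ : NonZero e}} where

  G₂ G₃ G₄ G₅ : ℕ → ℕ
  G₂ = addCoin a id
  G₃ = addCoin b G₂
  G₄ = addCoin d G₃
  G₅ = addCoin e G₄

  greedySize₄ : IsGreedySize (1 ∷ a ∷ b ∷ d ∷ []) G₄
  greedySize₄ = greedySize-∷ʳ _ d (greedySize-∷ʳ _ b (greedySize-∷ʳ _ a greedySize-[1]))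

  greedySize₅ : IsGreedySize (1 ∷ a ∷ b ∷ d ∷ e ∷ []) G₅
  greedySize₅ = greedySize-∷ʳ _ e greedySize₄

  G₂-0 : G₂ 0 ≡ 0
  G₂-0 = addCoin-< a id (>-nonZero⁻¹ a)

  G₃-0 : G₃ 0 ≡ 0
  G₃-0 = trans (addCoin-< b G₂ (>-nonZero⁻¹ b)) G₂-0

  G₄-0 : G₄ 0 ≡ 0
  G₄-0 = trans (addCoin-< d G₃ (>-nonZero⁻¹ d)) G₃-0

  G₅-0 : G₅ 0 ≡ 0
  G₅-0 = trans (addCoin-< e G₄ (>-nonZero⁻¹ e)) G₄-0

  G₂-pos : ∀ {x} → 0 < x → 0 < G₂ x
  G₂-pos = addCoin-pos a id id

  G₃-pos : ∀ {x} → 0 < x → 0 < G₃ x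
  G₃-pos = addCoin-pos b G₂ G₂-pos

  G₄-pos : ∀ {x} → 0 < x → 0 < G₄ x
  G₄-pos = addCoin-pos d G₃ G₃-pos

  G₅-pos : ∀ {x} → 0 < x → 0 < G₅ x
  G₅-pos = addCoin-pos e G₄ G₄-pos

  G₂-≤1 : ∀ {x} → G₂ x ≤ 1 → x ≤ 1 ⊎ x ≡ a
  G₂-≤1 = addCoin-≤1 a id id

  G₃-≤1 : ∀ {x} → G₃ x ≤ 1 → (x ≤ 1 ⊎ x ≡ a) ⊎ x ≡ b
  G₃-≤1 G₃x≤1 with addCoin-≤1 b G₂ G₂-pos G₃x≤1
  ... | inj₁ G₂x≤1 = inj₁ (G₂-≤1 G₂x≤1)
  ... | inj₂ x≡b   = inj₂ x≡b

  G₂-lipschitz-1 : CoinLipschitz G₂ 1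
  G₂-lipschitz-1 = addCoin-lipschitz a id 1 residue
    where
    residue : ∀ y → y < a → G₂ (suc y) ≤ suc (G₂ y)
    residue y y<a with suc y <? a
    ... | yes 1+y<a = ≤-reflexive (trans (addCoin-< a id 1+y<a) (cong suc (sym (addCoin-< a id y<a))))
    ... | no  1+y≮a = begin
      G₂ (suc y)     ≡⟨ cong G₂ (trans (≤-antisym y<a (≮⇒≥ 1+y≮a)) (sym (+-identityʳ a))) ⟩
      G₂ (a + 0)     ≡⟨ addCoin-+ a id 0 ⟩
      suc (G₂ 0)     ≡⟨ cong suc G₂-0 ⟩
      1              ≤⟨ s≤s z≤n ⟩
      suc (G₂ y)     ∎
      where open ≤-Reasoning

  Special : Set
  Special = 3 < b × a ≡ 2 × d ≡ b + 1 × e ≡ 2 * b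

  special? : Dec Special
  special? = 3 <? b ×-dec a ≟ 2 ×-dec d ≟ b + 1 ×-dec e ≟ 2 * b

  module Ordered (1<a : 1 < a) (a<b : a < b) (b<d : b < d) (d<e : d < e) where

    G₄≡G₂ : ∀ {x} → x < b → G₄ x ≡ G₂ x
    G₄≡G₂ x<b = trans (addCoin-< d G₃ (<-trans x<b b<d)) (addCoin-< b G₂ x<b)

    G₅≡G₂ : ∀ {x} → x < b → G₅ x ≡ G₂ x
    G₅≡G₂ x<b = trans (addCoin-< e G₄ (<-trans x<b (<-trans b<d d<e))) (G₄≡G₂ x<b)

    G₅[e+r]≤2⇒r≤1∨a∨b : ∀ {r} → r < d → G₅ (e + r) ≤ 2 → (r ≤ 1 ⊎ r ≡ a) ⊎ r ≡ b
    G₅[e+r]≤2⇒r≤1∨a∨b {r} r<d ≤2 = G₃-≤1 (≤-pred (subst (_≤ 2) G₅[e+r]≡ ≤2))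
      where
      G₅[e+r]≡ : G₅ (e + r) ≡ suc (G₃ r)
      G₅[e+r]≡ = trans (addCoin-+ e G₄ r) (cong suc (trans (addCoin-< e G₄ (<-trans r<d d<e)) (addCoin-< d G₃ r<d)))

    G₅[d+r]≤2⇒r≤1∨a : ∀ {r} → r < b → d + r < e → G₅ (d + r) ≤ 2 → r ≤ 1 ⊎ r ≡ a
    G₅[d+r]≤2⇒r≤1∨a {r} r<b d+r<e ≤2 = G₂-≤1 (≤-pred (subst (_≤ 2) G₅[d+r]≡ ≤2))
      where
      G₅[d+r]≡ : G₅ (d + r) ≡ suc (G₂ r)
      G₅[d+r]≡ = trans (addCoin-< e G₄ d+r<e) (trans (addCoin-+ d G₃ r) (cong suc (G₄≡G₂ r<b)))

    module Forward (lip₅ : Lipschitz (1 ∷ a ∷ b ∷ d ∷ e ∷ []) G₅) (not-special : ¬ Special) where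

      -- G₄ and G₅ agree below e, so G₄ inherits the bound from G₅ outside this window.
      Critical : ℕ → Set
      Critical k = ∀ {y} → y < d → e ≤ k + y → G₄ (k + y) ≤ suc (G₄ y)

      lipschitz₄-from-critical : ∀ {k} → CoinLipschitz G₅ k → Critical k → CoinLipschitz G₄ k
      lipschitz₄-from-critical {k} lip₅-k critical = addCoin-lipschitz d G₃ k residue
        where
        residue : ∀ y → y < d → G₄ (k + y) ≤ suc (G₄ y)
        residue y y<d with k + y <? e
        ... | yes k+y<e = subst₂ _≤_ (addCoin-< e G₄ k+y<e) (cong suc (addCoin-< e G₄ (<-trans y<d d<e))) (lip₅-k y)
        ... | no  k+y≮e = critical y<d (≮⇒≥ k+y≮e)

      G₅[b+b]≤2 : G₅ (b + b) ≤ 2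
      G₅[b+b]≤2 = lipschitz-two-coins G₅-0 (lip₅ (fsuc (fsuc fzero))) (lip₅ (fsuc (fsuc fzero)))

      G₅[b+d]≤2 : G₅ (b + d) ≤ 2
      G₅[b+d]≤2 = lipschitz-two-coins G₅-0 (lip₅ (fsuc (fsuc fzero))) (lip₅ (fsuc (fsuc (fsuc fzero))))

      G₅[d+d]≤2 : G₅ (d + d) ≤ 2
      G₅[d+d]≤2 = lipschitz-two-coins G₅-0 (lip₅ (fsuc (fsuc (fsuc fzero)))) (lip₅ (fsuc (fsuc (fsuc fzero))))

      -- Writing b + d = e + t and d + d = e + u, the bounds G₅ ≤ 2 force t ∈ {1, a} and u ∈ {a, b},
      -- while b + u = d + t forces t < u.
      data Shape : Set where
        d≡a+b-1 : e + 1 ≡ b + d → d + 1 ≡ b + a → Shape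
        d≡2b-1  : e + 1 ≡ b + d → d + 1 ≡ b + b → Shape
        d≡2b-a  : e + a ≡ b + d → d + a ≡ b + b → Shape

      shape : e < b + d → Shape
      shape e<b+d with m≤n⇒∃[o]m+o≡n (<⇒≤ e<b+d) | m≤n⇒∃[o]m+o≡n (<⇒≤ (<-trans e<b+d (+-monoˡ-< d b<d)))
      ... | t , e+t≡b+d | u , e+u≡d+d =
        classify (G₅[e+r]≤2⇒r≤1∨a∨b t<d (subst (λ x → G₅ x ≤ 2) (sym e+t≡b+d) G₅[b+d]≤2))
                 (G₅[e+r]≤2⇒r≤1∨a∨b u<d (subst (λ x → G₅ x ≤ 2) (sym e+u≡d+d) G₅[d+d]≤2))
        where
        t<b : t < b
        t<b = +-cancelˡ-< e t b (subst (_< e + b) (sym e+t≡b+d) (subst (b + d <_) (+-comm b e) (+-monoʳ-< b d<e)))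
        t<d : t < d
        t<d = <-trans t<b b<d
        u<d : u < d
        u<d = +-cancelˡ-< e u d (subst (_< e + d) (sym e+u≡d+d) (+-monoˡ-< d d<e))
        b+u≡d+t : b + u ≡ d + t
        b+u≡d+t = +-cancelˡ-≡ e _ _ (begin
          e + (b + u) ≡⟨ x∙yz≈y∙xz e b u ⟩
          b + (e + u) ≡⟨ cong (b +_) e+u≡d+d ⟩
          b + (d + d) ≡⟨ x∙yz≈y∙xz b d d ⟩
          d + (b + d) ≡⟨ cong (d +_) e+t≡b+d ⟨
          d + (e + t) ≡⟨ x∙yz≈y∙xz d e t ⟩
          e + (d + t) ∎)
          where open ≡-Reasoning
        t<u : t < u
        t<u = ≰⇒> λ u≤t → <-irrefl b+u≡d+t (+-mono-<-≤ b<d u≤t)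
        classify : (t ≤ 1 ⊎ t ≡ a) ⊎ t ≡ b → (u ≤ 1 ⊎ u ≡ a) ⊎ u ≡ b → Shape
        classify (inj₂ refl)              _                  = ⊥-elim (<-irrefl refl t<b)
        classify (inj₁ (inj₁ z≤n))        _                  =
          ⊥-elim (<-irrefl (trans (sym (+-identityʳ e)) e+t≡b+d) e<b+d)
        classify (inj₁ (inj₁ (s≤s z≤n))) (inj₁ (inj₁ u≤1)) = ⊥-elim (<⇒≱ t<u u≤1)
        classify (inj₁ (inj₁ (s≤s z≤n))) (inj₁ (inj₂ refl)) = d≡a+b-1 e+t≡b+d (sym b+u≡d+t)
        classify (inj₁ (inj₁ (s≤s z≤n))) (inj₂ refl)        = d≡2b-1 e+t≡b+d (sym b+u≡d+t)
        classify (inj₁ (inj₂ refl))       (inj₁ (inj₁ u≤1)) = ⊥-elim (<⇒≱ (<-trans 1<a t<u) u≤1)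
        classify (inj₁ (inj₂ refl))       (inj₁ (inj₂ refl)) = ⊥-elim (<-irrefl refl t<u)
        classify (inj₁ (inj₂ refl))       (inj₂ refl)        = d≡2b-a e+t≡b+d (sym b+u≡d+t)

      a+y<e : e + 1 ≡ b + d → ∀ {y} → y < d → a + y < e
      a+y<e e+1≡b+d {y} y<d = +-cancelʳ-< 1 (a + y) e (begin-strict
        a + y + 1   ≡⟨ +-assoc a y 1 ⟩
        a + (y + 1) ≡⟨ cong (a +_) (+-comm y 1) ⟩
        a + suc y   ≤⟨ +-monoʳ-≤ a y<d ⟩
        a + d       <⟨ +-monoˡ-< d a<b ⟩
        b + d       ≡⟨ e+1≡b+d ⟨
        e + 1       ∎)
        where open ≤-Reasoning

      suc-y≡d : e + 1 ≡ b + d → ∀ {y} → y < d → e ≤ b + y → suc y ≡ d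
      suc-y≡d e+1≡b+d {y} y<d e≤b+y = ≤-antisym y<d (+-cancelˡ-≤ b d (suc y) (begin
        b + d       ≡⟨ e+1≡b+d ⟨
        e + 1       ≤⟨ +-monoˡ-≤ 1 e≤b+y ⟩
        b + y + 1   ≡⟨ +-assoc b y 1 ⟩
        b + (y + 1) ≡⟨ cong (b +_) (+-comm y 1) ⟩
        b + suc y   ∎))
        where open ≤-Reasoning

      G₄[b+d-1] : ∀ {y b₁} → suc y ≡ d → suc b₁ ≡ b → G₄ (b + y) ≡ suc (G₂ b₁)
      G₄[b+d-1] {y} {b₁} refl refl = begin
        G₄ (suc b₁ + y)     ≡⟨ cong G₄ (trans (sym (+-suc b₁ y)) (+-comm b₁ (suc y))) ⟩
        G₄ (suc y + b₁)     ≡⟨ addCoin-+ (suc y) G₃ b₁ ⟩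
        suc (G₄ b₁)         ≡⟨ cong suc (G₄≡G₂ (n<1+n b₁)) ⟩
        suc (G₂ b₁)         ∎
        where open ≡-Reasoning

      y+2≡d+1 : ∀ {y} → suc y ≡ d → y + 2 ≡ d + 1
      y+2≡d+1 {y} 1+y≡d = trans (+-suc y 1) (cong (_+ 1) 1+y≡d)

      G₄[b+r] : ∀ {r} → r < b → b + r < d → G₄ (b + r) ≡ suc (G₂ r)
      G₄[b+r] {r} r<b b+r<d = trans (addCoin-< d G₃ b+r<d) (trans (addCoin-+ b G₂ r) (cong suc (addCoin-< b G₂ r<b)))

      critical-b-2b-1 : e + 1 ≡ b + d → d + 1 ≡ b + b → Critical b
      critical-b-2b-1 e+1≡b+d d+1≡b+b {y} y<d e≤b+y with b₂ , refl ← m≤n⇒∃[o]m+o≡n (<-trans 1<a a<b) = begin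
        G₄ (b + y)        ≡⟨ G₄[b+d-1] 1+y≡d refl ⟩
        suc (G₂ (suc b₂)) ≤⟨ s≤s (G₂-lipschitz-1 b₂) ⟩
        suc (suc (G₂ b₂)) ≡⟨ cong suc (G₄[b+r] (m<n+m b₂ z<s) (subst (_< d) y≡b+b₂ y<d)) ⟨
        suc (G₄ (b + b₂)) ≡⟨ cong (suc ∘ G₄) y≡b+b₂ ⟨
        suc (G₄ y)        ∎
        where
        open ≤-Reasoning
        1+y≡d : suc y ≡ d
        1+y≡d = suc-y≡d e+1≡b+d y<d e≤b+y
        y≡b+b₂ : y ≡ b + b₂
        y≡b+b₂ = x+2≡m+[2+k]⇒x≡m+k b b₂ (trans (y+2≡d+1 1+y≡d) d+1≡b+b)

      -- Here d + 2 ≤ 2b < e, so G₅ (2b) ≤ 2 forces 2b - d = a.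
      d+a≡b+b : e + 1 ≡ b + d → d + 1 ≡ b + a → 2 < a → d + a ≡ b + b
      d+a≡b+b e+1≡b+d d+1≡b+a 2<a = from-excess (proj₂ (m≤n⇒∃[o]m+o≡n (<⇒≤ d<b+b)))
        where
        d+2≤b+b : d + 2 ≤ b + b
        d+2≤b+b = begin
          d + 2       ≡⟨ +-assoc d 1 1 ⟨
          d + 1 + 1   ≡⟨ cong (_+ 1) d+1≡b+a ⟩
          b + a + 1   ≡⟨ +-assoc b a 1 ⟩
          b + (a + 1) ≡⟨ cong (b +_) (+-comm a 1) ⟩
          b + suc a   ≤⟨ +-monoʳ-≤ b a<b ⟩
          b + b       ∎
          where open ≤-Reasoning
        d<b+b : d < b + b
        d<b+b = <-≤-trans (m<m+n d z<s) d+2≤b+b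
        b+b<e : b + b < e
        b+b<e = +-cancelʳ-< 1 _ e (begin-strict
          b + b + 1 ≡⟨ trans (+-assoc b b 1) (cong (b +_) (+-comm b 1)) ⟩
          b + suc b <⟨ +-monoʳ-< b (+-cancelʳ-< 1 (suc b) d (subst₂ _<_ (+-suc b 1) (sym d+1≡b+a) (+-monoʳ-< b 2<a))) ⟩
          b + d     ≡⟨ e+1≡b+d ⟨
          e + 1     ∎)
          where open ≤-Reasoning
        from-excess : ∀ {w} → d + w ≡ b + b → d + a ≡ b + b
        from-excess {w} d+w≡b+b
          with G₅[d+r]≤2⇒r≤1∨a w<b (subst (_< e) (sym d+w≡b+b) b+b<e)
                                  (subst (λ x → G₅ x ≤ 2) (sym d+w≡b+b) G₅[b+b]≤2)
          where
          w<b : w < b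
          w<b = +-cancelˡ-< d w b (subst (_< d + b) (sym d+w≡b+b) (subst (b + b <_) (+-comm b d) (+-monoʳ-< b b<d)))
        ... | inj₁ w≤1  = ⊥-elim (<⇒≱ (+-cancelˡ-≤ d 2 w (subst (d + 2 ≤_) (sym d+w≡b+b) d+2≤b+b)) w≤1)
        ... | inj₂ refl = d+w≡b+b

      -- For a = 2 the bound fails exactly when b > 3, which is the special system.
      G₂[b-1]≤a-1 : e + 1 ≡ b + d → d + 1 ≡ b + a → ∀ {a₂ b₁} → 2 + a₂ ≡ a → suc b₁ ≡ b → G₂ b₁ ≤ suc a₂
      G₂[b-1]≤a-1 _ _ {zero} {zero} refl refl = z≤n
      G₂[b-1]≤a-1 _ _ {zero} {1}    refl refl = ≤-refl
      G₂[b-1]≤a-1 _ _ {zero} {2}    refl refl = ≤-refl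
      G₂[b-1]≤a-1 e+1≡b+d d+1≡b+a {zero} {suc (suc (suc _))} refl refl =
        ⊥-elim (not-special (s≤s (s≤s (s≤s z<s)) , refl , d≡b+1 , e≡2*b))
        where
        d≡b+1 : d ≡ b + 1
        d≡b+1 = +-cancelʳ-≡ 1 d (b + 1) (trans d+1≡b+a (sym (+-assoc b 1 1)))
        e≡2*b : e ≡ 2 * b
        e≡2*b = +-cancelʳ-≡ 1 e (2 * b) (begin
          e + 1           ≡⟨ e+1≡b+d ⟩
          b + d           ≡⟨ cong (b +_) d≡b+1 ⟩
          b + (b + 1)     ≡⟨ +-assoc b b 1 ⟨
          b + b + 1       ≡⟨ cong (λ x → b + x + 1) (+-identityʳ b) ⟨
          2 * b + 1       ∎)
          where open ≡-Reasoning
      G₂[b-1]≤a-1 e+1≡b+d d+1≡b+a {a₂@(suc _)} {b₁} refl refl = begin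
        G₂ b₁       ≡⟨ cong G₂ b₁≡a+a₂ ⟩
        G₂ (a + a₂) ≡⟨ addCoin-+ a id a₂ ⟩
        suc (G₂ a₂) ≡⟨ cong suc (addCoin-< a id (m<n+m a₂ {2} z<s)) ⟩
        suc a₂      ∎
        where
        open ≤-Reasoning
        b+1≡a+a : b + 1 ≡ a + a
        b+1≡a+a = +-cancelˡ-≡ b _ _ (begin-equality
          b + (b + 1) ≡⟨ +-assoc b b 1 ⟨
          b + b + 1   ≡⟨ cong (_+ 1) (d+a≡b+b e+1≡b+d d+1≡b+a (s≤s (s≤s (s≤s z≤n)))) ⟨
          d + a + 1   ≡⟨ xy∙z≈xz∙y d a 1 ⟩
          d + 1 + a   ≡⟨ cong (_+ a) d+1≡b+a ⟩
          b + a + a   ≡⟨ +-assoc b a a ⟩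
          b + (a + a) ∎)
        b₁≡a+a₂ : b₁ ≡ a + a₂
        b₁≡a+a₂ = x+2≡m+[2+k]⇒x≡m+k a a₂ (trans (+-suc b₁ 1) b+1≡a+a)

      critical-b-a+b-1 : e + 1 ≡ b + d → d + 1 ≡ b + a → Critical b
      critical-b-a+b-1 e+1≡b+d d+1≡b+a {y} y<d e≤b+y
        with a₂ , refl ← m≤n⇒∃[o]m+o≡n 1<a | b₁ , 1+b₁≡b ← m≤n⇒∃[o]m+o≡n (>-nonZero⁻¹ b) = begin
        G₄ (b + y)        ≡⟨ G₄[b+d-1] 1+y≡d 1+b₁≡b ⟩
        suc (G₂ b₁)       ≤⟨ s≤s (G₂[b-1]≤a-1 e+1≡b+d d+1≡b+a refl 1+b₁≡b) ⟩
        suc (suc a₂)      ≡⟨ cong (suc ∘ suc) (addCoin-< a id a₂<a) ⟨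
        suc (suc (G₂ a₂)) ≡⟨ cong suc (G₄[b+r] (<-trans a₂<a a<b) (subst (_< d) y≡b+a₂ y<d)) ⟨
        suc (G₄ (b + a₂)) ≡⟨ cong (suc ∘ G₄) y≡b+a₂ ⟨
        suc (G₄ y)        ∎
        where
        open ≤-Reasoning
        1+y≡d : suc y ≡ d
        1+y≡d = suc-y≡d e+1≡b+d y<d e≤b+y
        a₂<a : a₂ < a
        a₂<a = m<n+m a₂ z<s
        y≡b+a₂ : y ≡ b + a₂
        y≡b+a₂ = x+2≡m+[2+k]⇒x≡m+k b a₂ (trans (y+2≡d+1 1+y≡d) d+1≡b+a)

      -- Otherwise 2b = e + (2a - b) with 2 ≤ 2a - b < a, and G₅ (2b) = 2a - b + 1 > 2.
      a+a≤1+b : e + a ≡ b + d → d + a ≡ b + b → a + a ≤ suc b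
      a+a≤1+b e+a≡b+d d+a≡b+b with a + a ≤? suc b
      ... | yes a+a≤1+b = a+a≤1+b
      ... | no  a+a≰1+b with v , 2+b+v≡a+a ← m≤n⇒∃[o]m+o≡n (≰⇒> a+a≰1+b)
        = excluded (G₅[e+r]≤2⇒r≤1∨a∨b (<-trans 2+v<a (<-trans a<b b<d))
                                       (subst (λ x → G₅ x ≤ 2) b+b≡e+2+v G₅[b+b]≤2))
        where
        b+b≡e+2+v : b + b ≡ e + (2 + v)
        b+b≡e+2+v = +-cancelˡ-≡ b _ _ (begin
          b + (b + b)       ≡⟨ cong (b +_) d+a≡b+b ⟨
          b + (d + a)       ≡⟨ +-assoc b d a ⟨
          b + d + a         ≡⟨ cong (_+ a) e+a≡b+d ⟨
          e + a + a         ≡⟨ +-assoc e a a ⟩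
          e + (a + a)       ≡⟨ cong (e +_) 2+b+v≡a+a ⟨
          e + (2 + b + v)   ≡⟨ arrange e b v ⟩
          b + (e + (2 + v)) ∎)
          where
          open ≡-Reasoning
          arrange : ∀ e b v → e + (2 + b + v) ≡ b + (e + (2 + v))
          arrange = solve-∀
        2+v<a : 2 + v < a
        2+v<a = +-cancelʳ-< b (2 + v) a (subst (_< a + b) (trans (sym 2+b+v≡a+a) (xy∙z≈xz∙y 2 b v)) (+-monoʳ-< a a<b))
        excluded : (2 + v ≤ 1 ⊎ 2 + v ≡ a) ⊎ 2 + v ≡ b → a + a ≤ suc b
        excluded (inj₁ (inj₁ (s≤s ())))
        excluded (inj₁ (inj₂ 2+v≡a)) = ⊥-elim (<-irrefl 2+v≡a 2+v<a)
        excluded (inj₂ 2+v≡b)        = ⊥-elim (<-irrefl 2+v≡b (<-trans 2+v<a a<b))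

      critical-a-2b-a : e + a ≡ b + d → d + a ≡ b + b → Critical a
      critical-a-2b-a e+a≡b+d d+a≡b+b {y} y<d e≤a+y
        with a₂ , refl ← m≤n⇒∃[o]m+o≡n 1<a = ≤-reflexive (begin-equality
        G₄ (a + y)          ≡⟨ cong G₄ a+y≡d+1+a₂ ⟩
        G₄ (d + suc a₂)     ≡⟨ addCoin-+ d G₃ (suc a₂) ⟩
        suc (G₄ (suc a₂))   ≡⟨ cong suc (G₄≡G₂ (<-trans (n<1+n (suc a₂)) a<b)) ⟩
        suc (G₂ (suc a₂))   ≡⟨ cong suc (addCoin-< a id (n<1+n (suc a₂))) ⟩
        suc (suc a₂)        ≡⟨ cong (suc ∘ suc) (addCoin-< a id (m<n+m a₂ {2} z<s)) ⟨
        suc (suc (G₂ a₂))   ≡⟨ cong suc (G₄[b+r] (<-trans (m<n+m a₂ {2} z<s) a<b) (subst (_< d) y≡b+a₂ y<d)) ⟨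
        suc (G₄ (b + a₂))   ≡⟨ cong (suc ∘ G₄) y≡b+a₂ ⟨
        suc (G₄ y)          ∎)
        where
        open ≤-Reasoning
        1+b≡a+a : suc b ≡ a + a
        1+b≡a+a = ≤-antisym b<a+a (a+a≤1+b e+a≡b+d d+a≡b+b)
          where
          b<a+a : b < a + a
          b<a+a = +-cancelʳ-< d b (a + a) (begin-strict
            b + d     ≡⟨ e+a≡b+d ⟨
            e + a     ≤⟨ +-monoˡ-≤ a e≤a+y ⟩
            a + y + a <⟨ +-monoˡ-< a (+-monoʳ-< a y<d) ⟩
            a + d + a ≡⟨ xy∙z≈xz∙y a d a ⟩
            a + a + d ∎)
        1+y≡d : suc y ≡ d
        1+y≡d = ≤-antisym y<d (+-cancelˡ-≤ b d (suc y) (begin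
          b + d       ≡⟨ e+a≡b+d ⟨
          e + a       ≤⟨ +-monoˡ-≤ a e≤a+y ⟩
          a + y + a   ≡⟨ xy∙z≈xz∙y a y a ⟩
          a + a + y   ≡⟨ cong (_+ y) 1+b≡a+a ⟨
          suc b + y   ≡⟨ +-suc b y ⟨
          b + suc y   ∎))
        y≡b+a₂ : y ≡ b + a₂
        y≡b+a₂ = +-cancelʳ-≡ (2 + a) y (b + a₂) (begin-equality
          y + (2 + a)     ≡⟨ x∙yz≈y∙xz y 2 a ⟩
          2 + (y + a)     ≡⟨ cong (λ x → suc x + a) 1+y≡d ⟩
          suc (d + a)     ≡⟨ cong suc d+a≡b+b ⟩
          suc (b + b)     ≡⟨ +-suc b b ⟨
          b + suc b       ≡⟨ cong (b +_) 1+b≡a+a ⟩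
          b + (a + a)     ≡⟨ cong (b +_) (xy∙z≈xz∙y 2 a₂ a) ⟩
          b + (2 + a + a₂) ≡⟨ x∙yz≈xz∙y b (2 + a) a₂ ⟩
          b + a₂ + (2 + a) ∎)
        a+y≡d+1+a₂ : a + y ≡ d + suc a₂
        a+y≡d+1+a₂ = begin-equality
          suc (suc a₂) + y ≡⟨ +-suc (suc a₂) y ⟨
          suc a₂ + suc y   ≡⟨ cong (suc a₂ +_) 1+y≡d ⟩
          suc a₂ + d       ≡⟨ +-comm (suc a₂) d ⟩
          d + suc a₂       ∎

      z≤G₂[z+z] : ∀ {z} → suc z ≡ a → z ≤ G₂ (z + z)
      z≤G₂[z+z] {zero}   _    = z≤n
      z≤G₂[z+z] {suc z′} refl = ≤-reflexive (sym (begin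
        G₂ (suc z′ + suc z′) ≡⟨ cong G₂ (+-suc (suc z′) z′) ⟩
        G₂ (a + z′)          ≡⟨ addCoin-+ a id z′ ⟩
        suc (G₂ z′)          ≡⟨ cong suc (addCoin-< a id (<-trans (n<1+n z′) (n<1+n (suc z′)))) ⟩
        suc z′               ∎))
        where open ≡-Reasoning

      critical-b-2b-a : e + a ≡ b + d → d + a ≡ b + b → Critical b
      critical-b-2b-a e+a≡b+d d+a≡b+b {y} y<d e≤b+y
        with z , d+z≡b+y ← m≤n⇒∃[o]m+o≡n (<⇒≤ (<-≤-trans d<e e≤b+y)) = begin
        G₄ (b + y)   ≡⟨ cong G₄ d+z≡b+y ⟨
        G₄ (d + z)   ≡⟨ addCoin-+ d G₃ z ⟩
        suc (G₄ z)   ≡⟨ cong suc (G₄≡G₂ z<b) ⟩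
        suc (G₂ z)   ≤⟨ s≤s (G₂[z]≤G₄[y] (a ≤? z)) ⟩
        suc (G₄ y)   ∎
        where
        open ≤-Reasoning
        z<b : z < b
        z<b = +-cancelˡ-< d z b (subst₂ _<_ (sym d+z≡b+y) (+-comm b d) (+-monoʳ-< b y<d))
        y+a≡b+z : y + a ≡ b + z
        y+a≡b+z = +-cancelˡ-≡ b _ _ (begin-equality
          b + (y + a) ≡⟨ +-assoc b y a ⟨
          b + y + a   ≡⟨ cong (_+ a) d+z≡b+y ⟨
          d + z + a   ≡⟨ xy∙z≈xz∙y d z a ⟩
          d + a + z   ≡⟨ cong (_+ z) d+a≡b+b ⟩
          b + b + z   ≡⟨ +-assoc b b z ⟩
          b + (b + z) ∎)
        G₂[z]≤G₄[y] : Dec (a ≤ z) → G₂ z ≤ G₄ y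
        G₂[z]≤G₄[y] (yes a≤z) with z′ , refl ← m≤n⇒∃[o]m+o≡n a≤z = begin
          G₂ (a + z′)        ≡⟨ addCoin-+ a id z′ ⟩
          suc (G₂ z′)        ≡⟨ G₄[b+r] z′<b (subst (_< d) y≡b+z′ y<d) ⟨
          G₄ (b + z′)        ≡⟨ cong G₄ y≡b+z′ ⟨
          G₄ y               ∎
          where
          z′<b : z′ < b
          z′<b = ≤-<-trans (m≤n+m z′ a) z<b
          y≡b+z′ : y ≡ b + z′
          y≡b+z′ = +-cancelʳ-≡ a y (b + z′) (trans y+a≡b+z (x∙yz≈xz∙y b a z′))
        G₂[z]≤G₄[y] (no a≰z) = begin
          G₂ z          ≡⟨ addCoin-< a id z<a ⟩
          z             ≤⟨ z≤G₂[z+z] 1+z≡a ⟩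
          G₂ (z + z)    ≡⟨ cong G₂ y≡z+z ⟨
          G₂ y          ≡⟨ G₄≡G₂ (subst (_< b) (sym y≡z+z) (subst (z + z <_) (sym b≡z+a) (+-monoʳ-< z z<a))) ⟨
          G₄ y          ∎
          where
          z<a : z < a
          z<a = ≰⇒> a≰z
          2a≤1+b : a + a ≤ suc b
          2a≤1+b = a+a≤1+b e+a≡b+d d+a≡b+b
          b≤z+a : b ≤ z + a
          b≤z+a = +-cancelʳ-≤ d b (z + a) (begin
            b + d     ≡⟨ e+a≡b+d ⟨
            e + a     ≤⟨ +-monoˡ-≤ a e≤b+y ⟩
            b + y + a ≡⟨ cong (_+ a) d+z≡b+y ⟨
            d + z + a ≡⟨ xy∙z≈yz∙x d z a ⟩
            z + a + d ∎)
          1+z≡a : suc z ≡ a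
          1+z≡a = ≤-antisym z<a (+-cancelʳ-≤ a a (suc z) (≤-trans 2a≤1+b (s≤s b≤z+a)))
          b≡z+a : b ≡ z + a
          b≡z+a = ≤-antisym b≤z+a (≤-pred (subst (_≤ suc b) (cong (_+ a) (sym 1+z≡a)) 2a≤1+b))
          y≡z+z : y ≡ z + z
          y≡z+z = +-cancelʳ-≡ a y (z + z) (trans y+a≡b+z (trans (cong (_+ z) b≡z+a) (xy∙z≈xz∙y z a z)))

      e<b+d : ∀ {k y} → k ≤ b → y < d → e ≤ k + y → e < b + d
      e<b+d k≤b y<d e≤k+y = ≤-<-trans e≤k+y (+-mono-≤-< k≤b y<d)

      critical-1 : Critical 1
      critical-1 y<d e≤1+y = ⊥-elim (<⇒≱ (≤-<-trans y<d d<e) e≤1+y)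

      critical-a : Critical a
      critical-a y<d e≤a+y with shape (e<b+d (<⇒≤ a<b) y<d e≤a+y)
      ... | d≡a+b-1 e+1≡b+d _       = ⊥-elim (<⇒≱ (a+y<e e+1≡b+d y<d) e≤a+y)
      ... | d≡2b-1  e+1≡b+d _       = ⊥-elim (<⇒≱ (a+y<e e+1≡b+d y<d) e≤a+y)
      ... | d≡2b-a  e+a≡b+d d+a≡b+b = critical-a-2b-a e+a≡b+d d+a≡b+b y<d e≤a+y

      critical-b : Critical b
      critical-b y<d e≤b+y with shape (e<b+d ≤-refl y<d e≤b+y)
      ... | d≡a+b-1 e+1≡b+d d+1≡b+a = critical-b-a+b-1 e+1≡b+d d+1≡b+a y<d e≤b+y
      ... | d≡2b-1  e+1≡b+d d+1≡b+b = critical-b-2b-1 e+1≡b+d d+1≡b+b y<d e≤b+y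
      ... | d≡2b-a  e+a≡b+d d+a≡b+b = critical-b-2b-a e+a≡b+d d+a≡b+b y<d e≤b+y

      lipschitz₄ : Lipschitz (1 ∷ a ∷ b ∷ d ∷ []) G₄
      lipschitz₄ fzero                      = lipschitz₄-from-critical (lip₅ fzero) critical-1
      lipschitz₄ (fsuc fzero)               = lipschitz₄-from-critical (lip₅ (fsuc fzero)) critical-a
      lipschitz₄ (fsuc (fsuc fzero))        = lipschitz₄-from-critical (lip₅ (fsuc (fsuc fzero))) critical-b
      lipschitz₄ (fsuc (fsuc (fsuc fzero))) = ≤-reflexive ∘ addCoin-+ d G₃

-- The system ⟨1, 2, b, b + 1, 2b⟩

module SpecialSystem (b : ℕ) (3<b : 3 < b) where

  private instance
    b-nonZero : NonZero b
    b-nonZero = >-nonZero (<-trans z<s 3<b)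
    b+b-nonZero : NonZero (b + b)
    b+b-nonZero = >-nonZero (<-≤-trans (<-trans z<s 3<b) (m≤m+n b b))

  open FiveCoins 2 b (suc b) (b + b)

  2<b : 2 < b
  2<b = <-trans (n<1+n 2) 3<b

  1<b : 1 < b
  1<b = <-trans (n<1+n 1) 2<b

  b<b+b : suc b < b + b
  b<b+b = subst (_< b + b) (+-comm b 1) (+-monoʳ-< b 1<b)

  2<b+b : 2 < b + b
  2<b+b = <-trans 2<b (≤-<-trans (n≤1+n b) b<b+b)

  open Ordered (n<1+n 1) 2<b (n<1+n b) b<b+b

  G₄[b]≡1 : G₄ b ≡ 1
  G₄[b]≡1 = trans (addCoin-< (suc b) G₃ (n<1+n b))
                  (trans (cong G₃ (sym (+-identityʳ b))) (trans (addCoin-+ b G₂ 0) (cong suc G₃-0)))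

  G₄[0]≤1 : G₄ 0 ≤ 1
  G₄[0]≤1 = subst (_≤ 1) (sym G₄-0) z≤n

  G₄[1]≤1 : G₄ 1 ≤ 1
  G₄[1]≤1 = ≤-reflexive (G₄≡G₂ 1<b)

  G₄[1+b]≡1 : G₄ (suc b) ≡ 1
  G₄[1+b]≡1 = trans (cong G₄ (sym (+-identityʳ (suc b)))) (trans (addCoin-+ (suc b) G₃ 0) (cong suc G₄-0))

  2≤G₂ : ∀ {x} → 3 ≤ x → 2 ≤ G₂ x
  2≤G₂ {suc (suc x′)} (s≤s (s≤s 1≤x′)) = subst (2 ≤_) (sym (addCoin-+ 2 id x′)) (s≤s (G₂-pos 1≤x′))

  2<G₄[b+b] : 2 < G₄ (b + b)
  2<G₄[b+b] = begin-strict
    2                     <⟨ s≤s (2≤G₂ (pred-mono-≤ 3<b)) ⟩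
    suc (G₂ (pred b))     ≡⟨ cong suc (G₄≡G₂ (subst (pred b <_) (suc-pred b) (n<1+n (pred b)))) ⟨
    suc (G₄ (pred b))     ≡⟨ addCoin-+ (suc b) G₃ (pred b) ⟨
    G₄ (suc b + pred b)   ≡⟨ cong G₄ (trans (sym (+-suc b (pred b))) (cong (b +_) (suc-pred b))) ⟩
    G₄ (b + b)            ∎
    where open ≤-Reasoning

  noncanonical₄ : NonCanonical (1 ∷ 2 ∷ b ∷ suc b ∷ [])
  noncanonical₄ canonical =
    <⇒≱ 2<G₄[b+b] (lipschitz-two-coins {k = b} {l = b} G₄-0 (lip (fsuc (fsuc fzero))) (lip (fsuc (fsuc fzero))))
    where
    lip : Lipschitz (1 ∷ 2 ∷ b ∷ suc b ∷ []) G₄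
    lip = canonical⇒lipschitz greedySize₄ canonical

  G₂-mono : ∀ x → G₂ x ≤ G₂ (suc x)
  G₂-mono 0             = z≤n
  G₂-mono 1             = ≤-refl
  G₂-mono (suc (suc x)) = subst₂ _≤_ (sym (addCoin-+ 2 id x)) (sym (addCoin-+ 2 id (suc x))) (s≤s (G₂-mono x))

  b≤x≤1+b⇒G₄≤1 : ∀ {x} → b ≤ x → x ≤ suc b → G₄ x ≤ 1
  b≤x≤1+b⇒G₄≤1 b≤x x≤1+b with m≤n⇒m<n∨m≡n x≤1+b
  ... | inj₁ x<1+b = ≤-reflexive (trans (cong G₄ (≤-antisym (≤-pred x<1+b) b≤x)) G₄[b]≡1)
  ... | inj₂ refl  = ≤-reflexive G₄[1+b]≡1

  G₄[1+b+r] : ∀ {r} → r < b → G₄ (suc b + r) ≡ suc (G₂ r)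
  G₄[1+b+r] r<b = trans (addCoin-+ (suc b) G₃ _) (cong suc (G₄≡G₂ r<b))

  lipschitz₅-from-residues : ∀ k →
    (∀ y → y < suc b → k + y < b + b → G₄ (k + y) ≤ suc (G₄ y)) →
    (∀ {w y} → w < k → b + b + w ≡ k + y → G₅ (k + y) ≤ suc (G₅ y)) →
    CoinLipschitz G₅ k
  lipschitz₅-from-residues k below above = addCoin-lipschitz (b + b) G₄ k residue
    where
    residue : ∀ y → y < b + b → G₅ (k + y) ≤ suc (G₅ y)
    residue y y<e with k + y <? b + b
    ... | yes k+y<e = subst₂ _≤_ (sym (addCoin-< (b + b) G₄ k+y<e)) (cong suc (sym (addCoin-< (b + b) G₄ y<e)))
                             (addCoin-lipschitz-below (suc b) G₃ k (b + b) below y k+y<e)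
    ... | no  k+y≮e with w , e+w≡k+y ← m≤n⇒∃[o]m+o≡n (≮⇒≥ k+y≮e) =
      above (+-cancelˡ-< (b + b) w k (subst₂ _<_ (sym e+w≡k+y) (+-comm k (b + b)) (+-monoʳ-< k y<e))) e+w≡k+y

  lipschitz₅-small-excess : ∀ {k w y} → k < b + b → b + b + w ≡ k + y → w < suc b → G₄ w ≤ 1 →
                            G₅ (k + y) ≤ suc (G₅ y)
  lipschitz₅-small-excess {k} {w} {y} k<e e+w≡k+y w<1+b G₄w≤1 = begin
    G₅ (k + y)         ≡⟨ cong G₅ e+w≡k+y ⟨
    G₅ (b + b + w)     ≡⟨ addCoin-+ (b + b) G₄ w ⟩
    suc (G₅ w)         ≡⟨ cong suc (addCoin-< (b + b) G₄ (<-trans w<1+b b<b+b)) ⟩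
    suc (G₄ w)         ≤⟨ s≤s G₄w≤1 ⟩
    2                  ≤⟨ s≤s (G₅-pos 0<y) ⟩
    suc (G₅ y)         ∎
    where
    open ≤-Reasoning
    0<y : 0 < y
    0<y = ≰⇒> λ y≤0 → <⇒≱ k<e (subst (b + b ≤_) (trans e+w≡k+y (trans (cong (k +_) (n≤0⇒n≡0 y≤0)) (+-identityʳ k)))
                                         (m≤m+n (b + b) w))

  lipschitz₅-1 : CoinLipschitz G₅ 1
  lipschitz₅-1 = lipschitz₅-from-residues 1 below above
    where
    below : ∀ y → y < suc b → 1 + y < b + b → G₄ (1 + y) ≤ suc (G₄ y)
    below y y<1+b _ with suc y <? b
    ... | yes 1+y<b = subst₂ _≤_ (sym (G₄≡G₂ 1+y<b)) (cong suc (sym (G₄≡G₂ (<-trans (n<1+n y) 1+y<b))))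
                             (G₂-lipschitz-1 y)
    ... | no  1+y≮b = ≤-trans (b≤x≤1+b⇒G₄≤1 (≮⇒≥ 1+y≮b) y<1+b) (s≤s z≤n)
    above : ∀ {w y} → w < 1 → b + b + w ≡ 1 + y → G₅ (1 + y) ≤ suc (G₅ y)
    above (s≤s z≤n) e+w≡1+y = lipschitz₅-small-excess (≤-<-trans (s≤s z≤n) b<b+b) e+w≡1+y z<s G₄[0]≤1

  lipschitz₅-2 : CoinLipschitz G₅ 2
  lipschitz₅-2 = lipschitz₅-from-residues 2 below above
    where
    below : ∀ y → y < suc b → 2 + y < b + b → G₄ (2 + y) ≤ suc (G₄ y)
    below y y<1+b _ with 2 + y <? b | 2 + y ≤? suc b
    ... | yes 2+y<b | _ = ≤-reflexive (begin
      G₄ (2 + y)  ≡⟨ G₄≡G₂ 2+y<b ⟩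
      G₂ (2 + y)  ≡⟨ addCoin-+ 2 id y ⟩
      suc (G₂ y)  ≡⟨ cong suc (G₄≡G₂ (≤-<-trans (m≤n+m y 2) 2+y<b)) ⟨
      suc (G₄ y)  ∎)
      where open ≡-Reasoning
    ... | no 2+y≮b | yes 2+y≤1+b = ≤-trans (b≤x≤1+b⇒G₄≤1 (≮⇒≥ 2+y≮b) 2+y≤1+b) (s≤s z≤n)
    ... | no _     | no 2+y≰1+b with refl ← ≤-antisym (≤-pred y<1+b) (≤-pred (≤-pred (≰⇒> 2+y≰1+b))) =
      ≤-reflexive (begin
      G₄ (2 + b)       ≡⟨ cong (G₄ ∘ suc) (+-comm b 1) ⟨
      G₄ (suc b + 1)   ≡⟨ addCoin-+ (suc b) G₃ 1 ⟩
      suc (G₄ 1)       ≡⟨ cong suc (G₄≡G₂ 1<b) ⟩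
      2                ≡⟨ cong suc G₄[b]≡1 ⟨
      suc (G₄ b)       ∎)
      where open ≡-Reasoning
    above : ∀ {w y} → w < 2 → b + b + w ≡ 2 + y → G₅ (2 + y) ≤ suc (G₅ y)
    above z<s             e+w≡2+y = lipschitz₅-small-excess 2<b+b e+w≡2+y z<s G₄[0]≤1
    above (s≤s (s≤s z≤n)) e+w≡2+y = lipschitz₅-small-excess 2<b+b e+w≡2+y (s≤s (<⇒≤ 1<b)) G₄[1]≤1

  lipschitz₅-b : CoinLipschitz G₅ b
  lipschitz₅-b = lipschitz₅-from-residues b below above
    where
    below : ∀ y → y < suc b → b + y < b + b → G₄ (b + y) ≤ suc (G₄ y)
    below zero     _ _ = ≤-trans (≤-reflexive (trans (cong G₄ (+-identityʳ b)) G₄[b]≡1)) (s≤s z≤n)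
    below (suc y′) _ b+y<b+b = begin
      G₄ (b + suc y′)   ≡⟨ cong G₄ (+-suc b y′) ⟩
      G₄ (suc b + y′)   ≡⟨ G₄[1+b+r] (<-trans (n<1+n y′) y<b) ⟩
      suc (G₂ y′)       ≤⟨ s≤s (G₂-mono y′) ⟩
      suc (G₂ (suc y′)) ≡⟨ cong suc (G₄≡G₂ y<b) ⟨
      suc (G₄ (suc y′)) ∎
      where
      open ≤-Reasoning
      y<b : suc y′ < b
      y<b = +-cancelˡ-< b (suc y′) b b+y<b+b
    above : ∀ {w y} → w < b → b + b + w ≡ b + y → G₅ (b + y) ≤ suc (G₅ y)
    above {zero}   _   e+w≡b+y = lipschitz₅-small-excess (≤-<-trans (n≤1+n b) b<b+b) e+w≡b+y z<s G₄[0]≤1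
    above {suc w′} {y} w<b e+w≡b+y = begin
      G₅ (b + y)          ≡⟨ cong G₅ e+w≡b+y ⟨
      G₅ (b + b + suc w′) ≡⟨ addCoin-+ (b + b) G₄ (suc w′) ⟩
      suc (G₅ (suc w′))   ≡⟨ cong suc (G₅≡G₂ w<b) ⟩
      suc (G₂ (suc w′))   ≤⟨ s≤s (G₂-lipschitz-1 w′) ⟩
      suc (suc (G₂ w′))   ≡⟨ cong suc (G₄[1+b+r] (<-trans (n<1+n w′) w<b)) ⟨
      suc (G₄ (suc b + w′)) ≡⟨ cong (suc ∘ G₄) (trans (sym (+-suc b w′)) (sym y≡b+w)) ⟩
      suc (G₄ y)          ≡⟨ cong suc (addCoin-< (b + b) G₄ (subst (_< b + b) (sym y≡b+w) (+-monoʳ-< b w<b))) ⟨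
      suc (G₅ y)          ∎
      where
      open ≤-Reasoning
      y≡b+w : y ≡ b + suc w′
      y≡b+w = +-cancelˡ-≡ b _ _ (trans (sym e+w≡b+y) (+-assoc b b (suc w′)))

  lipschitz₅-1+b : CoinLipschitz G₅ (suc b)
  lipschitz₅-1+b = lipschitz₅-from-residues (suc b) below above
    where
    below : ∀ y → y < suc b → suc b + y < b + b → G₄ (suc b + y) ≤ suc (G₄ y)
    below y _ _ = ≤-reflexive (addCoin-+ (suc b) G₃ y)
    above : ∀ {w y} → w < suc b → b + b + w ≡ suc b + y → G₅ (suc b + y) ≤ suc (G₅ y)
    above {0}             _      e+w≡d+y = lipschitz₅-small-excess b<b+b e+w≡d+y z<s G₄[0]≤1
    above {1}             _      e+w≡d+y = lipschitz₅-small-excess b<b+b e+w≡d+y (s≤s (<⇒≤ 1<b)) G₄[1]≤1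
    above {suc (suc w₂)} {y} w<1+b e+w≡d+y with 2 + w₂ <? b
    ... | no 2+w₂≮b = lipschitz₅-small-excess b<b+b e+w≡d+y w<1+b (b≤x≤1+b⇒G₄≤1 (≮⇒≥ 2+w₂≮b) (<⇒≤ w<1+b))
    ... | yes 2+w₂<b = ≤-reflexive (begin-equality
      G₅ (suc b + y)          ≡⟨ cong G₅ e+w≡d+y ⟨
      G₅ (b + b + (2 + w₂))   ≡⟨ addCoin-+ (b + b) G₄ (2 + w₂) ⟩
      suc (G₅ (2 + w₂))       ≡⟨ cong suc (G₅≡G₂ 2+w₂<b) ⟩
      suc (G₂ (2 + w₂))       ≡⟨ cong suc (addCoin-+ 2 id w₂) ⟩
      suc (suc (G₂ w₂))       ≡⟨ cong suc (G₄[1+b+r] w₂<b) ⟨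
      suc (G₄ (suc b + w₂))   ≡⟨ cong (suc ∘ G₄) y≡1+b+w₂ ⟨
      suc (G₄ y)              ≡⟨ cong suc (addCoin-< (b + b) G₄ y<b+b) ⟨
      suc (G₅ y)              ∎)
      where
      open ≤-Reasoning
      w₂<b : w₂ < b
      w₂<b = ≤-<-trans (m≤n+m w₂ 2) 2+w₂<b
      y≡1+b+w₂ : y ≡ suc b + w₂
      y≡1+b+w₂ = +-cancelˡ-≡ (suc b) _ _ (trans (sym e+w≡d+y) (arrange b w₂))
        where
        arrange : ∀ b w₂ → b + b + (2 + w₂) ≡ suc b + (suc b + w₂)
        arrange = solve-∀
      y<b+b : y < b + b
      y<b+b = subst (_< b + b) (trans (+-suc b w₂) (sym y≡1+b+w₂)) (+-monoʳ-< b (≤-<-trans (n≤1+n (suc w₂)) 2+w₂<b))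

  lipschitz₅ : Lipschitz (1 ∷ 2 ∷ b ∷ suc b ∷ b + b ∷ []) G₅
  lipschitz₅ fzero                             = lipschitz₅-1
  lipschitz₅ (fsuc fzero)                      = lipschitz₅-2
  lipschitz₅ (fsuc (fsuc fzero))               = lipschitz₅-b
  lipschitz₅ (fsuc (fsuc (fsuc fzero)))        = lipschitz₅-1+b
  lipschitz₅ (fsuc (fsuc (fsuc (fsuc fzero)))) = ≤-reflexive ∘ addCoin-+ (b + b) G₄

  canonical₅ : Canonical (1 ∷ 2 ∷ b ∷ suc b ∷ b + b ∷ [])
  canonical₅ = lipschitz⇒canonical greedySize₅ G₅-0 lipschitz₅

module _ {a b d e : ℕ} (1<a : 1 < a) (a<b : a < b) (b<d : b < d) (d<e : d < e) where

  private
    0<a : 0 < a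
    0<a = <-trans z<s 1<a
    0<b : 0 < b
    0<b = <-trans 0<a a<b
    0<d : 0 < d
    0<d = <-trans 0<b b<d

    instance
      a-nonZero : NonZero a
      a-nonZero = >-nonZero 0<a
      b-nonZero : NonZero b
      b-nonZero = >-nonZero 0<b
      d-nonZero : NonZero d
      d-nonZero = >-nonZero 0<d
      e-nonZero : NonZero e
      e-nonZero = >-nonZero (<-trans 0<d d<e)

  open FiveCoins a b d e

  canonical₅⇒special-or-canonical₄ : Canonical (1 ∷ a ∷ b ∷ d ∷ e ∷ []) →
                                     Special ⊎ Canonical (1 ∷ a ∷ b ∷ d ∷ [])
  canonical₅⇒special-or-canonical₄ canonical₅ with special?
  ... | yes special     = inj₁ special
  ... | no  not-special = inj₂ (lipschitz⇒canonical greedySize₄ G₄-0 (Forward.lipschitz₄ lip₅ not-special))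
    where
    open Ordered 1<a a<b b<d d<e
    lip₅ : Lipschitz (1 ∷ a ∷ b ∷ d ∷ e ∷ []) G₅
    lip₅ = canonical⇒lipschitz greedySize₅ canonical₅

special-noncanonical₄ : ∀ {b} → 3 < b → NonCanonical (1 ∷ 2 ∷ b ∷ b + 1 ∷ [])
special-noncanonical₄ {b} 3<b =
  subst (λ d → NonCanonical (1 ∷ 2 ∷ b ∷ d ∷ [])) (+-comm 1 b) (SpecialSystem.noncanonical₄ b 3<b)

special-canonical₅ : ∀ {b} → 3 < b → Canonical (1 ∷ 2 ∷ b ∷ b + 1 ∷ 2 * b ∷ [])
special-canonical₅ {b} 3<b =
  subst₂ (λ d e → Canonical (1 ∷ 2 ∷ b ∷ d ∷ e ∷ [])) (+-comm 1 b) (cong (b +_) (sym (+-identityʳ b)))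
         (SpecialSystem.canonical₅ b 3<b)

theorem10 : (c₂ c₃ c₄ c₅ : ℕ) → 1 < c₂ → c₂ < c₃ → c₃ < c₄ → c₄ < c₅ →
    ((NonCanonical (1 ∷ c₂ ∷ c₃ ∷ c₄ ∷ []) × Canonical (1 ∷ c₂ ∷ c₃ ∷ c₄ ∷ c₅ ∷ []))
      ⇔ (3 < c₃ × c₂ ≡ 2 × c₄ ≡ c₃ + 1 × c₅ ≡ 2 * c₃))
theorem10 a b d e 1<a a<b b<d d<e = mk⇔ necessary sufficient
  where
  necessary : NonCanonical (1 ∷ a ∷ b ∷ d ∷ []) × Canonical (1 ∷ a ∷ b ∷ d ∷ e ∷ []) →
              3 < b × a ≡ 2 × d ≡ b + 1 × e ≡ 2 * b
  necessary (noncanonical₄ , canonical₅) with canonical₅⇒special-or-canonical₄ 1<a a<b b<d d<e canonical₅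
  ... | inj₁ special    = special
  ... | inj₂ canonical₄ = ⊥-elim (noncanonical₄ canonical₄)
  sufficient : 3 < b × a ≡ 2 × d ≡ b + 1 × e ≡ 2 * b →
               NonCanonical (1 ∷ a ∷ b ∷ d ∷ []) × Canonical (1 ∷ a ∷ b ∷ d ∷ e ∷ [])
  sufficient (3<b , refl , refl , refl) = special-noncanonical₄ 3<b , special-canonical₅ 3<b
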